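{- Let $g\ge 5$ be an integer. Every positive integer with exactly five base $g$ digits is a sum of three base $g$ palindromes.
   Context: Every nonnegative integer has a unique base $g$ representation $\delta_{l-1}\cdots\delta_0$ with digits $0\le \delta_j\le g-1$ and $\delta_{l-1}\ne 0$; it is a base $g$ palindrome if $\delta_{l-i}=\delta_{i-1}$ for all $i=1,\dots,\lfloor l/2\rfloor$. By convention $0$ is also considered a base $g$ palindrome. -}

module Defs where

open import Data.Nat using (ℕ; zero; suc; _+_; _*_; _^_; _≤_; _<_; NonZero)
open import Data.Nat.DivMod using (_/_; _%_)
open import Data.List using (List; []; _∷_; reverse)
open import Relation.Binary.PropositionalEquality using (_≡_)

-- Base-g digits of n, least significant first, with no leading zeros
-- (so 0 has the empty digit list). The fuel argument bounds the number of
-- division steps; fuel = n is always enough since g ≥ 2 below.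
digitsAux : (g : ℕ) → .{{_ : NonZero g}} → ℕ → ℕ → List ℕ
digitsAux g zero    n       = []
digitsAux g (suc f) zero    = []
digitsAux g (suc f) (suc n) = (suc n % g) ∷ digitsAux g f (suc n / g)

digits : (g : ℕ) → .{{_ : NonZero g}} → ℕ → List ℕ
digits g n = digitsAux g n n

-- n is a base g palindrome: its digit string reads the same reversed
-- (0, with empty digit string, is a palindrome by convention).
IsPalindrome : (g : ℕ) → .{{_ : NonZero g}} → ℕ → Set
IsPalindrome g n = reverse (digits g n) ≡ digits g n

open import Data.Nat using (s≤s)

≥5⇒NonZero : ∀ {g} → 5 ≤ g → NonZero g
≥5⇒NonZero (s≤s _) = _

module Submission where

-- Write n = a g⁴ + M with 0 < a < g and M < g⁴.  If M ≥ g² + a, subtract the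
-- five-digit palindrome x y w y x with x = a; otherwise, for a ≥ 2, borrow from
-- the leading digit and take x = a − 1.  Either way n − x (g⁴ + 1) =
-- g² + y (g³ + g) + s with y < g and s < g³ + g, so it remains to write g² + s
-- as w g² plus two palindromes of at most three digits, which a case analysis on
-- the last digits of s does explicitly.  The case a = 1, M ≤ g² is settled
-- directly with g⁴ − 1 = (g−1)(g−1)(g−1)(g−1) or g⁴ + 1 = 10001.

open import Defs
open import Data.Nat
open import Data.Nat.Properties
open import Data.Nat.DivMod
open import Data.Nat.Divisibility using (divides-refl)
open import Data.List using (List; []; _∷_; length; reverse)
open import Data.Product using (_×_; _,_; ∃-syntax)
open import Data.Sum using (inj₁; inj₂)
open import Relation.Binary.PropositionalEquality
open import Relation.Nullary using (yes; no; contradiction)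
open import Data.Nat.Tactic.RingSolver using (solve)

module _ {g : ℕ} .{{_ : NonZero g}} where

  fromDigits : List ℕ → ℕ
  fromDigits []      = 0
  fromDigits (d ∷ L) = d + fromDigits L * g

  -- Digit strings least significant first, as produced by digits; leading marks
  -- the most significant digit, which is nonzero.
  data Canonical : List ℕ → Set where
    leading : ∀ {d} → 0 < d → d < g → Canonical (d ∷ [])
    _∷_     : ∀ {d L} → d < g → Canonical L → Canonical (d ∷ L)

  canonical⇒1<g : ∀ {L} → Canonical L → 1 < g
  canonical⇒1<g (leading 0<d d<g) = ≤-<-trans 0<d d<g
  canonical⇒1<g (_ ∷ c)           = canonical⇒1<g c

  fromDigits-positive : ∀ {L} → Canonical L → 0 < fromDigits L
  fromDigits-positive (leading 0<d _) = ≤-trans 0<d (m≤m+n _ _)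
  fromDigits-positive {d ∷ L} (_ ∷ c) =
    <-≤-trans (fromDigits-positive c) (≤-trans (m≤m*n _ g) (m≤n+m _ d))

  length≤fromDigits : ∀ {L} → Canonical L → length L ≤ fromDigits L
  length≤fromDigits (leading 0<d _) = ≤-trans 0<d (m≤m+n _ _)
  length≤fromDigits {d ∷ L} (_ ∷ c) = begin
    suc (length L)       ≤⟨ s≤s (length≤fromDigits c) ⟩
    suc (fromDigits L)   ≤⟨ m<m*n _ g {{>-nonZero (fromDigits-positive c)}} (canonical⇒1<g c) ⟩
    fromDigits L * g     ≤⟨ m≤n+m _ d ⟩
    d + fromDigits L * g ∎
    where open ≤-Reasoning

  [d+m*g]%g≡d : ∀ {d} m → d < g → (d + m * g) % g ≡ d
  [d+m*g]%g≡d {d} m d<g = trans ([m+kn]%n≡m%n d m g) (m<n⇒m%n≡m d<g)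

  [d+m*g]/g≡m : ∀ {d} m → d < g → (d + m * g) / g ≡ m
  [d+m*g]/g≡m {d} m d<g = begin
    (d + m * g) / g   ≡⟨ +-distrib-/-∣ʳ d (divides-refl m) ⟩
    d / g + m * g / g ≡⟨ cong₂ _+_ (m<n⇒m/n≡0 d<g) (m*n/n≡m m g) ⟩
    m                 ∎
    where open ≡-Reasoning

  digitsAux-zero : ∀ f → digitsAux g f 0 ≡ []
  digitsAux-zero zero    = refl
  digitsAux-zero (suc f) = refl

  digitsAux-suc : ∀ f {n} → 0 < n → digitsAux g (suc f) n ≡ n % g ∷ digitsAux g f (n / g)
  digitsAux-suc f {suc n} _ = refl

  digitsAux-cons : ∀ f {d} m → d < g → 0 < d + m * g →
                   digitsAux g (suc f) (d + m * g) ≡ d ∷ digitsAux g f m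
  digitsAux-cons f m d<g pos = trans (digitsAux-suc f pos)
    (cong₂ (λ d′ m′ → d′ ∷ digitsAux g f m′) ([d+m*g]%g≡d m d<g) ([d+m*g]/g≡m m d<g))

  digitsAux-fromDigits : ∀ {L} f → Canonical L → length L ≤ f → digitsAux g f (fromDigits L) ≡ L
  digitsAux-fromDigits (suc f) c@(leading _ d<g) _ =
    trans (digitsAux-cons f 0 d<g (fromDigits-positive c)) (cong (_ ∷_) (digitsAux-zero f))
  digitsAux-fromDigits (suc f) c@(d<g ∷ c′) (s≤s len) =
    trans (digitsAux-cons f _ d<g (fromDigits-positive c)) (cong (_ ∷_) (digitsAux-fromDigits f c′ len))

  digits-fromDigits : ∀ {L} → Canonical L → digits g (fromDigits L) ≡ L
  digits-fromDigits c = digitsAux-fromDigits _ c (length≤fromDigits c)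

  palindrome-fromDigits : ∀ {L} → Canonical L → reverse L ≡ L → IsPalindrome g (fromDigits L)
  palindrome-fromDigits c rev = subst (λ D → reverse D ≡ D) (sym (digits-fromDigits c)) rev

  digit-palindrome : ∀ {d} → d < g → IsPalindrome g d
  digit-palindrome {zero}  _   = refl
  digit-palindrome {suc d} d<g =
    subst (IsPalindrome g) (+-identityʳ (suc d)) (palindrome-fromDigits (leading z<s d<g) refl)

  repdigit₂-palindrome : ∀ {d} → d < g → IsPalindrome g (d * (g + 1))
  repdigit₂-palindrome {zero}  _   = refl
  repdigit₂-palindrome {suc d} d<g =
    subst (IsPalindrome g) horner (palindrome-fromDigits (d<g ∷ leading z<s d<g) refl)
    where
    horner : suc d + (suc d + 0 * g) * g ≡ suc d * (g + 1)
    horner = solve (d ∷ g ∷ [])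

  palindrome₃ : ∀ {p q} → 0 < p → p < g → q < g → IsPalindrome g (p * (g * g + 1) + q * g)
  palindrome₃ {p} {q} 0<p p<g q<g =
    subst (IsPalindrome g) horner (palindrome-fromDigits (p<g ∷ q<g ∷ leading 0<p p<g) refl)
    where
    horner : p + (q + (p + 0 * g) * g) * g ≡ p * (g * g + 1) + q * g
    horner = solve (p ∷ q ∷ g ∷ [])

  repdigit₄-palindrome : ∀ {d} → d < g → IsPalindrome g (d * (g * g * g + g * g + g + 1))
  repdigit₄-palindrome {zero}  _   = refl
  repdigit₄-palindrome {suc d} d<g =
    subst (IsPalindrome g) horner (palindrome-fromDigits (d<g ∷ d<g ∷ d<g ∷ leading z<s d<g) refl)
    where
    horner : suc d + (suc d + (suc d + (suc d + 0 * g) * g) * g) * g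
           ≡ suc d * (g * g * g + g * g + g + 1)
    horner = solve (d ∷ g ∷ [])

  palindrome₅ : ∀ {x y w} → 0 < x → x < g → y < g → w < g →
                IsPalindrome g (x * (g * g * g * g + 1) + y * (g * g * g + g) + w * (g * g))
  palindrome₅ {x} {y} {w} 0<x x<g y<g w<g =
    subst (IsPalindrome g) horner (palindrome-fromDigits (x<g ∷ y<g ∷ w<g ∷ y<g ∷ leading 0<x x<g) refl)
    where
    horner : x + (y + (w + (y + (x + 0 * g) * g) * g) * g) * g
           ≡ x * (g * g * g * g + 1) + y * (g * g * g + g) + w * (g * g)
    horner = solve (x ∷ y ∷ w ∷ g ∷ [])

quotient-remainder : ∀ {n} q d .{{_ : NonZero d}} → n < q * d →
                     ∃[ a ] ∃[ r ] (a < q × r < d × n ≡ r + a * d)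
quotient-remainder {n} _ d n<qd = n / d , n % d , m<n*o⇒m/o<n n<qd , m%n<n n d , m≡m%n+[m/n]*n n d

SumOfThreePalindromes : (g : ℕ) .{{_ : NonZero g}} → ℕ → Set
SumOfThreePalindromes g n = ∃[ a ] ∃[ b ] ∃[ c ]
  (IsPalindrome g a × IsPalindrome g b × IsPalindrome g c × n ≡ a + b + c)

-- w becomes the middle digit of the five-digit palindrome x y w y x.
MiddlePlusTwoPalindromes : (g : ℕ) .{{_ : NonZero g}} → ℕ → Set
MiddlePlusTwoPalindromes g W = ∃[ w ] (w < g × ∃[ p ] ∃[ q ]
  (IsPalindrome g p × IsPalindrome g q × W ≡ w * (g * g) + p + q))

middle-split-<g³ : ∀ {g} .{{_ : NonZero g}} → 3 ≤ g → ∀ {w B C} → w < g → B < g → C < g →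
                   MiddlePlusTwoPalindromes g (g * g + (C + (B + w * g) * g))
middle-split-<g³ {g} 3≤g {w} {B} {suc C} w<g B<g C<g with h , refl ← m≤n⇒∃[o]m+o≡n 3≤g =
  w , w<g , 1 * (g * g + 1) + B * g , C ,
  palindrome₃ z<s (s≤s (s≤s z≤n)) B<g , digit-palindrome (<-trans (n<1+n C) C<g) ,
  solve (w ∷ B ∷ C ∷ h ∷ [])
middle-split-<g³ {g} 3≤g {w} {suc B} {zero} w<g B<g _ with h , refl ← m≤n⇒∃[o]m+o≡n 3≤g =
  w , w<g , 1 * (g * g + 1) + B * g , 2 + h ,
  palindrome₃ z<s (s≤s (s≤s z≤n)) (<-trans (n<1+n B) B<g) , digit-palindrome ≤-refl ,
  solve (w ∷ B ∷ h ∷ [])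
middle-split-<g³ {g} 3≤g {w} {zero} {zero} w<g _ _ with h , refl ← m≤n⇒∃[o]m+o≡n 3≤g =
  w , w<g , (2 + h) * (g + 1) , 1 ,
  repdigit₂-palindrome ≤-refl , digit-palindrome (s≤s (s≤s z≤n)) ,
  solve (w ∷ h ∷ [])

middle-split-≥g³ : ∀ {g} .{{_ : NonZero g}} → 3 ≤ g → ∀ {C} → C < g →
                   MiddlePlusTwoPalindromes g (g * g + (g * g * g + C))
middle-split-≥g³ {g} 3≤g {zero} _ with h , refl ← m≤n⇒∃[o]m+o≡n 3≤g =
  2 + h , ≤-refl , 1 * (g * g + 1) + 0 * g , (2 + h) * (g + 1) ,
  palindrome₃ z<s (s≤s (s≤s z≤n)) z<s , repdigit₂-palindrome ≤-refl ,
  solve (h ∷ [])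
middle-split-≥g³ {g} 3≤g {1} _ with h , refl ← m≤n⇒∃[o]m+o≡n 3≤g =
  1 + h , n≤1+n _ , 2 * (g * g + 1) + 0 * g , (2 + h) * (g + 1) ,
  palindrome₃ z<s (s≤s (s≤s (s≤s z≤n))) z<s , repdigit₂-palindrome ≤-refl ,
  solve (h ∷ [])
middle-split-≥g³ {g} 3≤g {suc (suc C)} C<g with h , refl ← m≤n⇒∃[o]m+o≡n 3≤g =
  2 + h , ≤-refl , 2 * (g * g + 1) + 0 * g , C ,
  palindrome₃ z<s (s≤s (s≤s (s≤s z≤n))) z<s ,
  digit-palindrome (<-trans (n<1+n C) (<-trans (n<1+n (suc C)) C<g)) ,
  solve (C ∷ h ∷ [])

middle-split : ∀ {g} .{{_ : NonZero g}} → 3 ≤ g → ∀ {r} → r < g * g * g + g →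
               MiddlePlusTwoPalindromes g (g * g + r)
middle-split {g} 3≤g {r} r<g³+g with r <? g * g * g
... | yes r<g³
  with wB , C , wB<g² , C<g , refl ← quotient-remainder (g * g) g r<g³
  with w , B , w<g , B<g , refl ← quotient-remainder g g wB<g²
  = middle-split-<g³ 3≤g w<g B<g C<g
... | no r≮g³
  with C , refl ← m≤n⇒∃[o]m+o≡n (≮⇒≥ r≮g³)
  = middle-split-≥g³ 3≤g (+-cancelˡ-< (g * g * g) C g r<g³+g)

outer-digit-sum : ∀ {g} .{{_ : NonZero g}} → 3 ≤ g →
                  ∀ {x r} → 0 < x → x < g → r < g * (g * g * g + g) →
                  SumOfThreePalindromes g (x * (g * g * g * g + 1) + (g * g + r))
outer-digit-sum {g} 3≤g {x} 0<x x<g r<gS with h , refl ← m≤n⇒∃[o]m+o≡n 3≤g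
  with y , s , y<g , s<S , refl ← quotient-remainder g (g * g * g + g) r<gS
  with w , w<g , p , q , pal-p , pal-q , s-split ← middle-split 3≤g s<S
  = x * (g * g * g * g + 1) + y * (g * g * g + g) + w * (g * g) , p , q ,
    palindrome₅ 0<x x<g y<g w<g , pal-p , pal-q , (begin
    x * (g * g * g * g + 1) + (g * g + (s + y * (g * g * g + g)))
      ≡⟨ solve (x ∷ y ∷ s ∷ h ∷ []) ⟩
    x * (g * g * g * g + 1) + y * (g * g * g + g) + (g * g + s)
      ≡⟨ cong (x * (g * g * g * g + 1) + y * (g * g * g + g) +_) s-split ⟩
    x * (g * g * g * g + 1) + y * (g * g * g + g) + (w * (g * g) + p + q)
      ≡⟨ solve (x ∷ y ∷ w ∷ p ∷ q ∷ h ∷ []) ⟩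
    x * (g * g * g * g + 1) + y * (g * g * g + g) + w * (g * g) + p + q ∎)
  where open ≡-Reasoning

g⁴+two-digits-sum : ∀ {g} .{{_ : NonZero g}} → 3 ≤ g → ∀ {B C} → B < g → C < g →
                    SumOfThreePalindromes g (C + B * g + 1 * (g * g * g * g))
g⁴+two-digits-sum {g} 3≤g {zero} {C} _ C<g with h , refl ← m≤n⇒∃[o]m+o≡n 3≤g =
  (2 + h) * (g * g * g + g * g + g + 1) , C , 1 ,
  repdigit₄-palindrome ≤-refl , digit-palindrome C<g , digit-palindrome (s≤s (s≤s z≤n)) ,
  solve (C ∷ h ∷ [])
g⁴+two-digits-sum {g} 3≤g {suc B} {C} B<g C<g with suc B ≤? C
... | yes B≤C with k , refl ← m≤n⇒∃[o]m+o≡n B≤C | h , refl ← m≤n⇒∃[o]m+o≡n 3≤g =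
  (2 + h) * (g * g * g + g * g + g + 1) , suc B * (g + 1) , suc k ,
  repdigit₄-palindrome ≤-refl , repdigit₂-palindrome B<g ,
  digit-palindrome (≤-<-trans (s≤s (m≤n+m k B)) C<g) ,
  solve (B ∷ k ∷ h ∷ [])
... | no B≰C with k , refl ← m≤n⇒∃[o]m+o≡n (m<1+n⇒m≤n (≰⇒> B≰C))
  with e , refl ← m≤n⇒∃[o]m+o≡n (≤-trans (s≤s (m≤n+m k C)) (<⇒≤ B<g)) =
  1 * (g * g * g * g + 1) + 0 * (g * g * g + g) + 0 * (g * g) , (C + k) * (g + 1) , e ,
  palindrome₅ z<s (≤-trans (s≤s (s≤s z≤n)) 3≤g) z<s z<s ,
  repdigit₂-palindrome (<-trans (n<1+n (C + k)) B<g) , digit-palindrome (s≤s (m≤n+m e k)) ,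
  solve (C ∷ k ∷ e ∷ [])

g⁴+at-most-g²-sum : ∀ {g} .{{_ : NonZero g}} → 3 ≤ g → ∀ {M} → M ≤ g * g →
                    SumOfThreePalindromes g (M + 1 * (g * g * g * g))
g⁴+at-most-g²-sum {g} 3≤g M≤g² with m≤n⇒m<n∨m≡n M≤g²
... | inj₁ M<g² with B , C , B<g , C<g , refl ← quotient-remainder g g M<g² =
  g⁴+two-digits-sum 3≤g B<g C<g
... | inj₂ refl with h , refl ← m≤n⇒∃[o]m+o≡n 3≤g =
  (2 + h) * (g * g * g + g * g + g + 1) , 1 * (g * g + 1) + 0 * g , 0 ,
  repdigit₄-palindrome ≤-refl , palindrome₃ z<s (s≤s (s≤s z≤n)) z<s , digit-palindrome z<s ,
  solve (h ∷ [])

g²+g≤g⁴ : ∀ {g} → 3 ≤ g → g * g + g ≤ g * g * g * g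
g²+g≤g⁴ {g} 3≤g with h , refl ← m≤n⇒∃[o]m+o≡n 3≤g =
  subst (g * g + g ≤_) (sym expand) (m≤m+n _ _)
  where
  -- g⁴ − g² − g = g (g³ − g − 1)
  expand : g * g * g * g ≡ g * g + g + g * (23 + 26 * h + 9 * h * h + h * h * h)
  expand = solve (h ∷ [])

leading-digit-sum : ∀ {g} .{{_ : NonZero g}} → 3 ≤ g →
                    ∀ {a M} → 0 < a → a < g → M < g * g * g * g →
                    SumOfThreePalindromes g (M + a * (g * g * g * g))
leading-digit-sum {g} 3≤g {a} {M} 0<a a<g M<g⁴ with a + g * g ≤? M
... | yes a+g²≤M with r , refl ← m≤n⇒∃[o]m+o≡n a+g²≤M =
  subst (SumOfThreePalindromes g) regroup (outer-digit-sum 3≤g 0<a a<g r<gS)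
  where
  regroup : a * (g * g * g * g + 1) + (g * g + r) ≡ a + g * g + r + a * (g * g * g * g)
  regroup = solve (a ∷ r ∷ g ∷ [])
  r<gS : r < g * (g * g * g + g)
  r<gS = begin-strict
    r                     ≤⟨ m≤n+m r (a + g * g) ⟩
    a + g * g + r         <⟨ M<g⁴ ⟩
    g * g * g * g         ≤⟨ m≤m+n _ (g * g) ⟩
    g * g * g * g + g * g ≡⟨ solve (g ∷ []) ⟩
    g * (g * g * g + g)   ∎
    where open ≤-Reasoning
leading-digit-sum {g} 3≤g {1} {M} _ _ _ | no 1+g²≰M =
  g⁴+at-most-g²-sum 3≤g (m<1+n⇒m≤n (≰⇒> 1+g²≰M))
leading-digit-sum {g} 3≤g {suc x@(suc y)} {M} _ a<g M<g⁴ | no a+g²≰M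
  with e , g⁴≡ ← m≤n⇒∃[o]m+o≡n (≤-trans (+-monoʳ-≤ (g * g) (<⇒≤ (<-trans (n<1+n x) a<g)))
                                         (g²+g≤g⁴ 3≤g)) =
  subst (SumOfThreePalindromes g) regroup (outer-digit-sum 3≤g z<s (<-trans (n<1+n x) a<g) r<gS)
  where
  regroup : x * (g * g * g * g + 1) + (g * g + (e + M)) ≡ M + suc x * (g * g * g * g)
  regroup = begin
    x * (g * g * g * g + 1) + (g * g + (e + M))   ≡⟨ solve (y ∷ e ∷ M ∷ g ∷ []) ⟩
    x * (g * g * g * g) + (g * g + x + e) + M     ≡⟨ cong (λ t → x * (g * g * g * g) + t + M) g⁴≡ ⟩
    x * (g * g * g * g) + g * g * g * g + M       ≡⟨ solve (y ∷ M ∷ g ∷ []) ⟩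
    M + suc x * (g * g * g * g)                   ∎
    where open ≡-Reasoning
  r<gS : e + M < g * (g * g * g + g)
  r<gS = begin-strict
    e + M                 ≤⟨ +-monoʳ-≤ e (m<1+n⇒m≤n (≰⇒> a+g²≰M)) ⟩
    e + (x + g * g)       ≡⟨ solve (y ∷ e ∷ g ∷ []) ⟩
    g * g + x + e         ≡⟨ g⁴≡ ⟩
    g * g * g * g         <⟨ m<m+n _ (>-nonZero⁻¹ (g * g) {{m*n≢0 g g}}) ⟩
    g * g * g * g + g * g ≡⟨ solve (g ∷ []) ⟩
    g * (g * g * g + g)   ∎
    where open ≤-Reasoning

m^4≡m*m*m*m : ∀ g → g ^ 4 ≡ g * g * g * g
m^4≡m*m*m*m g = unfolded
  where
  unfolded : g * (g * (g * (g * 1))) ≡ g * g * g * g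
  unfolded = solve (g ∷ [])

five-digit-sum : ∀ {g} .{{_ : NonZero g}} → 3 ≤ g → ∀ {n} → g ^ 4 ≤ n → n < g ^ 5 →
                 SumOfThreePalindromes g n
five-digit-sum {g} 3≤g g⁴≤n n<g⁵ with quotient-remainder g (g ^ 4) {{m^n≢0 g 4}} n<g⁵
... | zero , M , _ , M<g⁴ , refl =
  contradiction g⁴≤n (<⇒≱ (subst (_< g ^ 4) (sym (+-identityʳ M)) M<g⁴))
... | suc a , M , a<g , M<g⁴ , refl =
  subst (λ X → SumOfThreePalindromes g (M + suc a * X)) (sym (m^4≡m*m*m*m g))
        (leading-digit-sum 3≤g z<s a<g (subst (M <_) (m^4≡m*m*m*m g) M<g⁴))

lemma4p5 : (g : ℕ) → (5≤g : 5 ≤ g) → (n : ℕ) → g ^ 4 ≤ n → n < g ^ 5 →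
    ∃[ a ] ∃[ b ] ∃[ c ] (IsPalindrome g {{≥5⇒NonZero 5≤g}} a × IsPalindrome g {{≥5⇒NonZero 5≤g}} b × IsPalindrome g {{≥5⇒NonZero 5≤g}} c × n ≡ a + b + c)
lemma4p5 g 5≤g n = five-digit-sum {{≥5⇒NonZero 5≤g}} (≤-trans (s≤s (s≤s (s≤s z≤n))) 5≤g)
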